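{- Let $\gamma\in(0,1)$ and let $X_0\to Y_0,\ldots,X_k\to Y_k$ be partial implications on $[n]$ with $k\ge1$. If $\gamma\ge (k-1)/k$, then the following are equivalent: 1. $X_1\to Y_1,\ldots,X_k\to Y_k\models_\gamma X_0\to Y_0$; 2. there is a set $L\subseteq[k]$ such that $\{X_i\to Y_i: i\in L\}\models_\gamma X_0\to Y_0$ holds properly; 3. either $Y_0\subseteq X_0$, or there is a non-empty $L\subseteq[k]$ such that (a) $\{X_i\to Y_i: i\in L\}$ enforces homogeneity, (b) $\bigcup_{i\in L}X_i\subseteq X_0\subseteq\bigcup_{i\in L}X_iY_i$, and (c) $Y_0\subseteq X_0\cup\bigcap_{i\in L}Y_i$.
   Context: Attributes are the elements of $[n]$; a transaction is a subset of $[n]$; a data-set $\mathcal D$ is a finite multiset of transactions; $\mathrm{C}_{\mathcal D}[X]$ counts transactions of $\mathcal D$ containing $X$ with multiplicity. A partial implication $X\to Y$ is a pair of subsets of $[n]$; $XY=X\cup Y$. $\mathcal D\models_\gamma X\to Y$ means $\mathrm{C}_{\mathcal D}[X]=0$ or $\mathrm{C}_{\mathcal D}[XY]/\mathrm{C}_{\mathcal D}[X]\ge\gamma$. For a set $\Sigma$ of partial implications, $\Sigma\models_\gamma X_0\to Y_0$ means every data-set on $[n]$ satisfying all members of $\Sigma$ at $\gamma$ satisfies $X_0\to Y_0$ at $\gamma$; it holds properly if it holds and fails for every proper subset of $\Sigma$ (an entailment from the empty set holds properly whenever it holds). A set $\{X_i\to Y_i: i\in L\}$ enforces homogeneity if for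 every $Z\subseteq[n]$: if for all $i\in L$ either $X_i\not\subseteq Z$ or $X_iY_i\subseteq Z$, then either $X_i\not\subseteq Z$ for all $i\in L$, or $X_iY_i\subseteq Z$ for all $i\in L$. -}

module Defs where

open import Data.Nat using (ℕ; zero; suc)
open import Data.Integer using (+_)
open import Data.Rational using (ℚ; _/_; _*_; _≤_)
open import Data.Fin using (Fin)
open import Data.Fin.Subset using (Subset; _⊆_; _⊂_; _∈_; _∪_; ⋃; ⋂)
open import Data.Fin.Subset.Properties using (_⊆?_; _∈?_)
open import Data.List using (List; length; filter; map; allFin)
open import Data.Sum using (_⊎_)
open import Data.Product using (_×_)
open import Relation.Binary.PropositionalEquality using (_≡_)
open import Relation.Nullary using (¬_)

ℕtoℚ : ℕ → ℚ
ℕtoℚ c = (+ c) / 1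

-- a transaction is a subset of [n]; a data-set is a finite multiset (list) of transactions
DataSet : ℕ → Set
DataSet n = List (Subset n)

C : ∀ {n} → DataSet n → Subset n → ℕ
C D X = length (filter (X ⊆?_) D)

Sat : ∀ {n} → ℚ → DataSet n → Subset n → Subset n → Set
Sat γ D X Y = C D X ≡ 0 ⊎ γ * ℕtoℚ (C D X) ≤ ℕtoℚ (C D (X ∪ Y))

Entails : ∀ {n k} → ℚ → (X Y : Fin k → Subset n) → Subset k → Subset n → Subset n → Set
Entails {n} γ X Y L X0 Y0 =
  (D : DataSet n) → (∀ i → i ∈ L → Sat γ D (X i) (Y i)) → Sat γ D X0 Y0

EntailsProperly : ∀ {n k} → ℚ → (X Y : Fin k → Subset n) → Subset k → Subset n → Subset n → Set
EntailsProperly γ X Y L X0 Y0 =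
  Entails γ X Y L X0 Y0 × (∀ L′ → L′ ⊂ L → ¬ Entails γ X Y L′ X0 Y0)

EnforcesHomogeneity : ∀ {n k} → (X Y : Fin k → Subset n) → Subset k → Set
EnforcesHomogeneity {n} X Y L =
  (Z : Subset n) →
  (∀ i → i ∈ L → ¬ (X i ⊆ Z) ⊎ (X i ∪ Y i) ⊆ Z) →
  (∀ i → i ∈ L → ¬ (X i ⊆ Z)) ⊎ (∀ i → i ∈ L → (X i ∪ Y i) ⊆ Z)

members : ∀ {k} → Subset k → List (Fin k)
members L = filter (_∈? L) (allFin _)

⋃[_]_ : ∀ {n k} → Subset k → (Fin k → Subset n) → Subset n
⋃[ L ] f = ⋃ (map f (members L))

⋂[_]_ : ∀ {n k} → Subset k → (Fin k → Subset n) → Subset n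
⋂[ L ] f = ⋂ (map f (members L))

module Submission where

-- Write γ = a/b.  For an implication U → V a transaction Z has weight
-- b·[U ∪ V ⊆ Z] − a·[U ⊆ Z]: b − a if Z covers U ∪ V, −a if Z violates U → V
-- (contains U but not U ∪ V), 0 if Z avoids U.  A data-set satisfies U → V at γ
-- iff its total weight is ≥ 0, so entailment is about integer linear inequalities.
--   Soundness: if the premises L meet condition (3), every transaction satisfies
-- Σ_{i∈L} wᵢ(Z) ≤ |L|·w₀(Z); the one delicate case needs |L|(b − a) ≤ b, which is
-- γ ≥ (k−1)/k.  Summing over a data-set gives L ⊨ X0 → Y0.
--   Completeness (a constructive Farkas lemma): either some transaction lets us
-- drop a premise while keeping a refutation extendable, or none does and the
-- premises meet condition (3); dropping premises until none is left yields a
-- data-set refuting the entailment.  So entailment is decidable, and an entailing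
-- set shrinks to a minimal one, which entails properly.

open import Defs
open import Data.Nat as ℕ using (ℕ; zero; suc; _∸_) renaming (_≤_ to _≤ℕ_)
import Data.Nat.Properties as ℕP
open import Data.Integer as ℤ using (ℤ; +_; 0ℤ; 1ℤ; _+_; _*_; _-_; -_)
import Data.Integer.Properties as ℤP
open import Data.Integer.Tactic.RingSolver using (solve-∀)
open import Data.Rational as ℚ using (ℚ; ↥_; ↧_; ↧ₙ_; toℚᵘ; 0ℚ; 1ℚ; mkℚ; _<_; _≤_)
import Data.Rational.Properties as ℚP
open import Data.Rational.Unnormalised as ℚᵘ using (mkℚᵘ; *≤*)
import Data.Rational.Unnormalised.Properties as ℚᵘP
open import Data.List using (List; []; _∷_; _++_; replicate; concat; length; map; allFin)
import Data.List.Properties as ListP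
open import Data.List.Membership.Propositional using () renaming (_∈_ to _∈ₗ_)
open import Data.List.Membership.Propositional.Properties using (∈-filter⁺; ∈-filter⁻; ∈-allFin)
open import Data.List.Relation.Unary.Any using (here; there)
open import Data.Fin using (Fin)
open import Data.Fin.Properties using (any?; all?) renaming (_≟_ to _≟ᶠ_)
open import Data.Fin.Subset
  using (Subset; _∈_; _∉_; _⊆_; _⊂_; _∪_; ⋃; ⋂; ⊤; ∁; ⁅_⁆; Nonempty)
  renaming (_-_ to _without_)
open import Data.Fin.Subset.Properties
  using (_⊆?_; _∈?_; _⊂?_; ⊆-refl; ⊆-trans; p⊆p∪q; q⊆p∪q; x∈p∪q⁻; x∈p∪q⁺; x∈p∩q⁻; x∈p∩q⁺; ∈⊤; ∉⊥;
         x∉p⇒x∈∁p; x∈∁p⇒x∉p; x∈⁅x⁆; x∈⁅y⁆⇒x≡y; x∈p⇒p-x⊂p; x∈p∧x≢y⇒x∈p-y; anySubset?)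
open import Data.Fin.Subset.Induction using (⊂-wellFounded)
open import Induction.WellFounded using (module All)
open import Data.Product using (Σ; _×_; _,_; proj₁; proj₂)
open import Data.Sum as Sum using (_⊎_; inj₁; inj₂; [_,_]′)
open import Data.Empty using (⊥-elim)
open import Data.Bool using (if_then_else_)
open import Relation.Nullary using (¬_; Dec; yes; no; does; ¬?)
open import Relation.Nullary.Decidable using (_×-dec_; _→-dec_)
open import Relation.Binary.PropositionalEquality
open import Function using (_∘_)
open import Function.Bundles using (_⇔_; mk⇔; module Equivalence)

module RationalBounds where

  private
    ℕtoℚ-unnormalised : ∀ c → toℚᵘ (ℕtoℚ c) ℚᵘ.≃ mkℚᵘ (+ c) 0
    ℕtoℚ-unnormalised c = ℚP.toℚᵘ-fromℚᵘ (mkℚᵘ (+ c) 0)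

    scaled-unnormalised : ∀ p c → toℚᵘ (p ℚ.* ℕtoℚ c) ℚᵘ.≃ toℚᵘ p ℚᵘ.* mkℚᵘ (+ c) 0
    scaled-unnormalised p c =
      ℚᵘP.≃-trans (ℚP.toℚᵘ-homo-* p (ℕtoℚ c)) (ℚᵘP.*-congˡ {toℚᵘ p} (ℕtoℚ-unnormalised c))

  scaled-≤⇔ : ∀ p c c′ → (p ℚ.* ℕtoℚ c ≤ ℕtoℚ c′) ⇔ (↥ p * + c ℤ.≤ ↧ p * + c′)
  scaled-≤⇔ p@(mkℚ _ _ _) c c′ = mk⇔ to from
    where
    unit-rearrange : ∀ x y → y * (x * 1ℤ) ≡ x * y
    unit-rearrange = solve-∀
    lhs : ↥ p * + c * 1ℤ ≡ ↥ p * + c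
    lhs = ℤP.*-identityʳ (↥ p * + c)
    rhs : + c′ * (↧ p * 1ℤ) ≡ ↧ p * + c′
    rhs = unit-rearrange (↧ p) (+ c′)
    to : p ℚ.* ℕtoℚ c ≤ ℕtoℚ c′ → ↥ p * + c ℤ.≤ ↧ p * + c′
    to h with ℚᵘP.≤-respʳ-≃ (ℕtoℚ-unnormalised c′)
                (ℚᵘP.≤-respˡ-≃ (scaled-unnormalised p c) (ℚP.toℚᵘ-mono-≤ h))
    ... | *≤* q = subst₂ ℤ._≤_ lhs rhs q
    from : ↥ p * + c ℤ.≤ ↧ p * + c′ → p ℚ.* ℕtoℚ c ≤ ℕtoℚ c′
    from h = ℚP.toℚᵘ-cancel-≤ (ℚᵘP.≤-respʳ-≃ (ℚᵘP.≃-sym (ℕtoℚ-unnormalised c′))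
               (ℚᵘP.≤-respˡ-≃ (ℚᵘP.≃-sym (scaled-unnormalised p c))
                 (*≤* (subst₂ ℤ._≤_ (sym lhs) (sym rhs) h))))

  numerator-pos : ∀ p → 0ℚ < p → 0ℤ ℤ.< ↥ p
  numerator-pos p@(mkℚ _ _ _) (ℚ.*<* h) = subst₂ ℤ._<_ (ℤP.*-zeroˡ (↧ p)) (ℤP.*-identityʳ _) h

  numerator<denominator : ∀ p → p < 1ℚ → ↥ p ℤ.< ↧ p
  numerator<denominator p@(mkℚ _ _ _) (ℚ.*<* h) =
    subst₂ ℤ._<_ (ℤP.*-identityʳ _) (ℤP.*-identityˡ (↧ p)) h

  confidence-bound : ∀ p k → 1 ≤ℕ k → ℕtoℚ (k ∸ 1) ≤ p ℚ.* ℕtoℚ k → + k * (↧ p - ↥ p) ℤ.≤ ↧ p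
  confidence-bound p@(mkℚ _ _ _) (suc k′) _ h with
    ℚᵘP.≤-respʳ-≃ (scaled-unnormalised p (suc k′)) (ℚᵘP.≤-respˡ-≃ (ℕtoℚ-unnormalised k′) (ℚP.toℚᵘ-mono-≤ h))
  ... | *≤* q = begin
    + suc k′ * (↧ p - ↥ p)             ≡⟨ regroup (+ k′) (↧ p) (↥ p) ⟩
    (+ k′ * ↧ p - ↥ p * + suc k′) + ↧ p ≤⟨ ℤP.+-monoˡ-≤ (↧ p) (ℤP.i≤j⇒i-j≤0 [k-1]b≤ak) ⟩
    0ℤ + ↧ p                            ≡⟨ ℤP.+-identityˡ (↧ p) ⟩
    ↧ p                                 ∎
    where
    open ℤP.≤-Reasoning
    regroup : ∀ k b a → (1ℤ + k) * (b - a) ≡ (k * b - a * (1ℤ + k)) + b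
    regroup = solve-∀
    [k-1]b≤ak : + k′ * ↧ p ℤ.≤ ↥ p * + suc k′
    [k-1]b≤ak = subst₂ ℤ._≤_ (cong (+ k′ *_) (ℤP.*-identityʳ (↧ p))) (ℤP.*-identityʳ _) q

module Signs where

  0≤* : ∀ {c x} → 0ℤ ℤ.≤ c → 0ℤ ℤ.≤ x → 0ℤ ℤ.≤ c * x
  0≤* {c} {x} 0≤c 0≤x = subst (ℤ._≤ c * x) (ℤP.*-zeroʳ c) (ℤP.*-monoˡ-≤-nonNeg c {{ℤ.nonNegative 0≤c}} 0≤x)

  *≤0 : ∀ {c x} → 0ℤ ℤ.≤ c → x ℤ.≤ 0ℤ → c * x ℤ.≤ 0ℤ
  *≤0 {c} {x} 0≤c x≤0 = subst (c * x ℤ.≤_) (ℤP.*-zeroʳ c) (ℤP.*-monoˡ-≤-nonNeg c {{ℤ.nonNegative 0≤c}} x≤0)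
module Sums where

  private
    variable
      A B : Set

  ∑[_]_ : List A → (A → ℤ) → ℤ
  ∑[ [] ] f = 0ℤ
  ∑[ x ∷ xs ] f = f x + ∑[ xs ] f

  infix 10 ∑[_]_

  ∑-++ : ∀ xs ys (f : A → ℤ) → ∑[ xs ++ ys ] f ≡ ∑[ xs ] f + ∑[ ys ] f
  ∑-++ [] ys f = sym (ℤP.+-identityˡ _)
  ∑-++ (x ∷ xs) ys f rewrite ∑-++ xs ys f = sym (ℤP.+-assoc (f x) _ _)

  ∑-replicate : ∀ m z (f : A → ℤ) → ∑[ replicate m z ] f ≡ + m * f z
  ∑-replicate zero z f = sym (ℤP.*-zeroˡ (f z))
  ∑-replicate (suc m) z f rewrite ∑-replicate m z f = sym (ℤP.suc-* (+ m) (f z))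

  ∑-copies : ∀ c xs (f : A → ℤ) → ∑[ concat (replicate c xs) ] f ≡ + c * ∑[ xs ] f
  ∑-copies zero xs f = sym (ℤP.*-zeroˡ (∑[ xs ] f))
  ∑-copies (suc c) xs f rewrite ∑-++ xs (concat (replicate c xs)) f | ∑-copies c xs f =
    sym (ℤP.suc-* (+ c) (∑[ xs ] f))

  ∑-zero : (xs : List A) → ∑[ xs ] (λ _ → 0ℤ) ≡ 0ℤ
  ∑-zero [] = refl
  ∑-zero (x ∷ xs) = trans (ℤP.+-identityˡ _) (∑-zero xs)

  ∑-- : ∀ xs (f g : A → ℤ) → ∑[ xs ] (λ z → f z - g z) ≡ ∑[ xs ] f - ∑[ xs ] g
  ∑-- [] f g = refl
  ∑-- (x ∷ xs) f g rewrite ∑-- xs f g = interchange (f x) (g x) (∑[ xs ] f) (∑[ xs ] g)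
    where
    interchange : ∀ a b c d → a - b + (c - d) ≡ a + c - (b + d)
    interchange = solve-∀

  ∑-* : ∀ xs c (f : A → ℤ) → ∑[ xs ] (λ z → c * f z) ≡ c * ∑[ xs ] f
  ∑-* [] c f = sym (ℤP.*-zeroʳ c)
  ∑-* (x ∷ xs) c f rewrite ∑-* xs c f = sym (ℤP.*-distribˡ-+ c (f x) _)

  ∑-swap : (xs : List A) (ys : List B) (f : A → B → ℤ) →
    ∑[ xs ] (λ i → ∑[ ys ] f i) ≡ ∑[ ys ] (λ z → ∑[ xs ] (λ i → f i z))
  ∑-swap [] ys f = sym (∑-zero ys)
  ∑-swap (x ∷ xs) ys f rewrite ∑-swap xs ys f = sym (∑-+ ys)
    where
    ∑-+ : (ys : List B) {g h : B → ℤ} → ∑[ ys ] (λ z → g z + h z) ≡ ∑[ ys ] g + ∑[ ys ] h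
    ∑-+ [] = refl
    ∑-+ (y ∷ ys) {g} {h} rewrite ∑-+ ys {g} {h} = interchange (g y) (h y) _ _
      where
      interchange : ∀ a b c d → a + b + (c + d) ≡ a + c + (b + d)
      interchange = solve-∀

  ∑-mono : ∀ xs {f g : A → ℤ} → (∀ z → f z ℤ.≤ g z) → ∑[ xs ] f ℤ.≤ ∑[ xs ] g
  ∑-mono [] f≤g = ℤP.≤-refl
  ∑-mono (x ∷ xs) f≤g = ℤP.+-mono-≤ (f≤g x) (∑-mono xs f≤g)

  ∑-nonneg : ∀ xs {f : A → ℤ} → (∀ z → z ∈ₗ xs → 0ℤ ℤ.≤ f z) → 0ℤ ℤ.≤ ∑[ xs ] f
  ∑-nonneg [] f≥0 = ℤP.≤-refl
  ∑-nonneg (x ∷ xs) f≥0 = ℤP.+-mono-≤ (f≥0 x (here refl)) (∑-nonneg xs (λ z z∈ → f≥0 z (there z∈)))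

  ∑-≥ : ∀ xs {f : A → ℤ} c → (∀ z → c ℤ.≤ f z) → + length xs * c ℤ.≤ ∑[ xs ] f
  ∑-≥ [] c c≤f = ℤP.≤-refl
  ∑-≥ (x ∷ xs) {f} c c≤f = subst (ℤ._≤ ∑[ x ∷ xs ] f) (sym (ℤP.suc-* (+ length xs) c))
    (ℤP.+-mono-≤ (c≤f x) (∑-≥ xs c c≤f))

  ∑-≤ : ∀ xs {f : A → ℤ} c → (∀ z → z ∈ₗ xs → f z ℤ.≤ c) → ∑[ xs ] f ℤ.≤ + length xs * c
  ∑-≤ [] c f≤c = ℤP.≤-refl
  ∑-≤ (x ∷ xs) {f} c f≤c = subst (∑[ x ∷ xs ] f ℤ.≤_) (sym (ℤP.suc-* (+ length xs) c))
    (ℤP.+-mono-≤ (f≤c x (here refl)) (∑-≤ xs c (λ z z∈ → f≤c z (there z∈))))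

  ∑-≤-one-smaller : ∀ xs {f : A → ℤ} c d {y} → y ∈ₗ xs → f y ℤ.≤ c - d →
    (∀ z → z ∈ₗ xs → f z ℤ.≤ c) → ∑[ xs ] f ℤ.≤ + length xs * c - d
  ∑-≤-one-smaller (x ∷ xs) {f} c d (here refl) fx≤ f≤c =
    subst (∑[ x ∷ xs ] f ℤ.≤_) (regroup (+ length xs) c d)
      (ℤP.+-mono-≤ fx≤ (∑-≤ xs c (λ z z∈ → f≤c z (there z∈))))
    where
    regroup : ∀ m c d → c - d + m * c ≡ (1ℤ + m) * c - d
    regroup = solve-∀
  ∑-≤-one-smaller (x ∷ xs) {f} c d (there y∈) fy≤ f≤c =
    subst (∑[ x ∷ xs ] f ℤ.≤_) (regroup (+ length xs) c d)
      (ℤP.+-mono-≤ (f≤c x (here refl)) (∑-≤-one-smaller xs c d y∈ fy≤ (λ z z∈ → f≤c z (there z∈))))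
    where
    regroup : ∀ m c d → c + (m * c - d) ≡ (1ℤ + m) * c - d
    regroup = solve-∀

module IndexSets where

  private
    variable
      n k : ℕ

  members⁺ : ∀ {L : Subset k} {i} → i ∈ L → i ∈ₗ members L
  members⁺ {L = L} {i} i∈L = ∈-filter⁺ (_∈? L) (∈-allFin i) i∈L

  members⁻ : ∀ {L : Subset k} {i} → i ∈ₗ members L → i ∈ L
  members⁻ {k} {L} i∈ = proj₂ (∈-filter⁻ (_∈? L) {xs = allFin k} i∈)

  length-members : ∀ (L : Subset k) → length (members L) ≤ℕ k
  length-members {k} L = ℕP.≤-trans (ListP.length-filter (_∈? L) (allFin k))
                                (ℕP.≤-reflexive (ListP.length-tabulate (λ i → i)))

  ⊆-⋃[] : ∀ (f : Fin k → Subset n) {L : Subset k} {i} → i ∈ L → f i ⊆ ⋃[ L ] f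
  ⊆-⋃[] f {L} i∈L = ⊆-⋃ (members L) (members⁺ i∈L)
    where
    ⊆-⋃ : ∀ is {i} → i ∈ₗ is → f i ⊆ ⋃ (map f is)
    ⊆-⋃ (j ∷ is) (here refl) = p⊆p∪q _
    ⊆-⋃ (j ∷ is) (there i∈) = q⊆p∪q (f j) _ ∘ ⊆-⋃ is i∈

  ⋃[]-least : ∀ (f : Fin k → Subset n) {L : Subset k} {Z} → (∀ i → i ∈ L → f i ⊆ Z) → ⋃[ L ] f ⊆ Z
  ⋃[]-least f {L} {Z} bound = ⋃-least (members L) (λ i i∈ → bound i (members⁻ i∈))
    where
    ⋃-least : ∀ is → (∀ i → i ∈ₗ is → f i ⊆ Z) → ⋃ (map f is) ⊆ Z
    ⋃-least [] _ x∈ = ⊥-elim (∉⊥ x∈)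
    ⋃-least (j ∷ is) bound x∈ with x∈p∪q⁻ (f j) _ x∈
    ... | inj₁ x∈fj = bound j (here refl) x∈fj
    ... | inj₂ x∈⋃ = ⋃-least is (λ i i∈ → bound i (there i∈)) x∈⋃

  ⋂[]-⊆ : ∀ (f : Fin k → Subset n) {L : Subset k} {i} → i ∈ L → ⋂[ L ] f ⊆ f i
  ⋂[]-⊆ f {L} i∈L = ⋂-⊆ (members L) (members⁺ i∈L)
    where
    ⋂-⊆ : ∀ is {i} → i ∈ₗ is → ⋂ (map f is) ⊆ f i
    ⋂-⊆ (j ∷ is) (here refl) = proj₁ ∘ x∈p∩q⁻ (f j) _
    ⋂-⊆ (j ∷ is) (there i∈) = ⋂-⊆ is i∈ ∘ proj₂ ∘ x∈p∩q⁻ (f j) _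

  ∈-⋂[] : ∀ (f : Fin k → Subset n) {L : Subset k} {x} → (∀ i → i ∈ L → x ∈ f i) → x ∈ ⋂[ L ] f
  ∈-⋂[] f {L} {x} x∈all = ∈-⋂ (members L) (λ i i∈ → x∈all i (members⁻ i∈))
    where
    ∈-⋂ : ∀ is → (∀ i → i ∈ₗ is → x ∈ f i) → x ∈ ⋂ (map f is)
    ∈-⋂ [] _ = ∈⊤
    ∈-⋂ (j ∷ is) x∈all = x∈p∩q⁺ (x∈all j (here refl) , ∈-⋂ is (λ i i∈ → x∈all i (there i∈)))


module Weights {n : ℕ} (γ : ℚ) (a>0 : 0ℤ ℤ.< ↥ γ) (a<b : ↥ γ ℤ.< ↧ γ) where
  open Sums
  open Signs

  a b : ℤ
  a = ↥ γ
  b = ↧ γ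

  1≤a : 1ℤ ℤ.≤ a
  1≤a = ℤP.i<j⇒suc[i]≤j a>0

  1≤b-a : 1ℤ ℤ.≤ b - a
  1≤b-a = subst (ℤ._≤ b - a) (cancel a) (ℤP.+-monoˡ-≤ (- a) (ℤP.i<j⇒suc[i]≤j a<b))
    where
    cancel : ∀ a → 1ℤ + a - a ≡ 1ℤ
    cancel = solve-∀

  0≤b-a : 0ℤ ℤ.≤ b - a
  0≤b-a = ℤP.≤-trans (ℤ.+≤+ ℕ.z≤n) 1≤b-a

  0≤b : 0ℤ ℤ.≤ b
  0≤b = ℤP.≤-trans (ℤP.<⇒≤ a>0) (ℤP.<⇒≤ a<b)

  -a≤0 : - a ℤ.≤ 0ℤ
  -a≤0 = ℤP.neg-mono-≤ (ℤP.<⇒≤ a>0)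

  -a≤b-a : - a ℤ.≤ b - a
  -a≤b-a = ℤP.≤-trans -a≤0 0≤b-a

  𝟙[_⊆_] : Subset n → Subset n → ℤ
  𝟙[ U ⊆ Z ] = if does (U ⊆? Z) then 1ℤ else 0ℤ

  𝟙-yes : ∀ {U Z} → U ⊆ Z → 𝟙[ U ⊆ Z ] ≡ 1ℤ
  𝟙-yes {U} {Z} U⊆Z with U ⊆? Z
  ... | yes _ = refl
  ... | no U⊈Z = ⊥-elim (U⊈Z U⊆Z)

  𝟙-no : ∀ {U Z} → ¬ (U ⊆ Z) → 𝟙[ U ⊆ Z ] ≡ 0ℤ
  𝟙-no {U} {Z} U⊈Z with U ⊆? Z
  ... | yes U⊆Z = ⊥-elim (U⊈Z U⊆Z)
  ... | no _ = refl

  count-as-sum : ∀ (D : DataSet n) U → + C D U ≡ ∑[ D ] (λ Z → 𝟙[ U ⊆ Z ])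
  count-as-sum [] U = refl
  count-as-sum (z ∷ D) U with U ⊆? z
  ... | yes _ = cong (λ c → 1ℤ + c) (count-as-sum D U)
  ... | no _ = trans (count-as-sum D U) (sym (ℤP.+-identityˡ _))

  weight : Subset n → Subset n → Subset n → ℤ
  weight U V Z = b * 𝟙[ U ∪ V ⊆ Z ] - a * 𝟙[ U ⊆ Z ]

  total-weight : ∀ (D : DataSet n) U V → ∑[ D ] weight U V ≡ b * + C D (U ∪ V) - a * + C D U
  total-weight D U V = begin
    ∑[ D ] weight U V
      ≡⟨ ∑-- D (λ Z → b * 𝟙[ U ∪ V ⊆ Z ]) (λ Z → a * 𝟙[ U ⊆ Z ]) ⟩
    ∑[ D ] (λ Z → b * 𝟙[ U ∪ V ⊆ Z ]) - ∑[ D ] (λ Z → a * 𝟙[ U ⊆ Z ])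
      ≡⟨ cong₂ _-_ (∑-* D b _) (∑-* D a _) ⟩
    b * ∑[ D ] (λ Z → 𝟙[ U ∪ V ⊆ Z ]) - a * ∑[ D ] (λ Z → 𝟙[ U ⊆ Z ])
      ≡⟨ cong₂ (λ x y → b * x - a * y) (sym (count-as-sum D (U ∪ V))) (sym (count-as-sum D U)) ⟩
    b * + C D (U ∪ V) - a * + C D U ∎
    where open ≡-Reasoning

  sat⇔weight≥0 : ∀ (D : DataSet n) U V → Sat γ D U V ⇔ 0ℤ ℤ.≤ ∑[ D ] weight U V
  sat⇔weight≥0 D U V = mk⇔ to from
    where
    open RationalBounds using (scaled-≤⇔)
    to : Sat γ D U V → 0ℤ ℤ.≤ ∑[ D ] weight U V
    to (inj₁ no-support) = subst (0ℤ ℤ.≤_) (sym (total-weight D U V))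
      (subst (λ c → 0ℤ ℤ.≤ b * + C D (U ∪ V) - a * + c) (sym no-support)
        (subst (0ℤ ℤ.≤_) (minus-zero (b * + C D (U ∪ V)) a) (0≤* 0≤b (ℤ.+≤+ ℕ.z≤n))))
      where
      minus-zero : ∀ x a → x ≡ x - a * 0ℤ
      minus-zero = solve-∀
    to (inj₂ confident) = subst (0ℤ ℤ.≤_) (sym (total-weight D U V))
      (ℤP.i≤j⇒0≤j-i (Equivalence.to (scaled-≤⇔ γ (C D U) (C D (U ∪ V))) confident))
    from : 0ℤ ℤ.≤ ∑[ D ] weight U V → Sat γ D U V
    from w≥0 = inj₂ (Equivalence.from (scaled-≤⇔ γ (C D U) (C D (U ∪ V)))
                      (ℤP.0≤i-j⇒j≤i (subst (0ℤ ℤ.≤_) (total-weight D U V) w≥0)))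

  Violates : Subset n → Subset n → Subset n → Set
  Violates U V Z = U ⊆ Z × ¬ (U ∪ V ⊆ Z)

  violates? : ∀ U V Z → Dec (Violates U V Z)
  violates? U V Z = (U ⊆? Z) ×-dec ¬? (U ∪ V ⊆? Z)

  data Position (U V Z : Subset n) : Set where
    covers   : U ∪ V ⊆ Z → Position U V Z
    violates : Violates U V Z → Position U V Z
    avoids   : ¬ (U ⊆ Z) → Position U V Z

  position : ∀ U V Z → Position U V Z
  position U V Z with U ∪ V ⊆? Z | U ⊆? Z
  ... | yes UV⊆Z | _ = covers UV⊆Z
  ... | no UV⊈Z | yes U⊆Z = violates (U⊆Z , UV⊈Z)
  ... | no _ | no U⊈Z = avoids U⊈Z

  not-violated⇒avoids-or-covers : ∀ {U V Z} → ¬ Violates U V Z → ¬ (U ⊆ Z) ⊎ U ∪ V ⊆ Z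
  not-violated⇒avoids-or-covers {U} {V} {Z} not-violated with position U V Z
  ... | covers UV⊆Z = inj₂ UV⊆Z
  ... | violates violated = ⊥-elim (not-violated violated)
  ... | avoids U⊈Z = inj₁ U⊈Z

  avoids-or-covers⇒not-violated : ∀ {U V Z} → ¬ (U ⊆ Z) ⊎ U ∪ V ⊆ Z → ¬ Violates U V Z
  avoids-or-covers⇒not-violated (inj₁ U⊈Z) (U⊆Z , _) = U⊈Z U⊆Z
  avoids-or-covers⇒not-violated (inj₂ UV⊆Z) (_ , UV⊈Z) = UV⊈Z UV⊆Z

  weight-covers : ∀ {U V Z} → U ∪ V ⊆ Z → weight U V Z ≡ b - a
  weight-covers {U} {V} UV⊆Z
    rewrite 𝟙-yes UV⊆Z | 𝟙-yes (UV⊆Z ∘ p⊆p∪q {p = U} V) | ℤP.*-identityʳ b | ℤP.*-identityʳ a = refl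

  weight-violates : ∀ {U V Z} → Violates U V Z → weight U V Z ≡ - a
  weight-violates (U⊆Z , UV⊈Z)
    rewrite 𝟙-yes U⊆Z | 𝟙-no UV⊈Z | ℤP.*-zeroʳ b | ℤP.*-identityʳ a = ℤP.+-identityˡ (- a)

  weight-avoids : ∀ {U V Z} → ¬ (U ⊆ Z) → weight U V Z ≡ 0ℤ
  weight-avoids {U} {V} U⊈Z
    rewrite 𝟙-no U⊈Z | 𝟙-no {U ∪ V} (λ UV⊆Z → U⊈Z (UV⊆Z ∘ p⊆p∪q V)) | ℤP.*-zeroʳ b | ℤP.*-zeroʳ a = refl

  weight-≤ : ∀ U V Z → weight U V Z ℤ.≤ b - a
  weight-≤ U V Z with position U V Z
  ... | covers UV⊆Z = ℤP.≤-reflexive (weight-covers {U} {V} UV⊆Z)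
  ... | violates violated = subst (ℤ._≤ b - a) (sym (weight-violates {U} {V} violated)) -a≤b-a
  ... | avoids U⊈Z = subst (ℤ._≤ b - a) (sym (weight-avoids {U} {V} U⊈Z)) 0≤b-a

  weight-≥ : ∀ U V Z → - a ℤ.≤ weight U V Z
  weight-≥ U V Z with position U V Z
  ... | covers UV⊆Z = subst (- a ℤ.≤_) (sym (weight-covers {U} {V} UV⊆Z)) -a≤b-a
  ... | violates violated = ℤP.≤-reflexive (sym (weight-violates {U} {V} violated))
  ... | avoids U⊈Z = subst (- a ℤ.≤_) (sym (weight-avoids {U} {V} U⊈Z)) -a≤0

  weight-≥0 : ∀ U V Z → ¬ Violates U V Z → 0ℤ ℤ.≤ weight U V Z
  weight-≥0 U V Z not-violated with position U V Z
  ... | covers UV⊆Z = subst (0ℤ ℤ.≤_) (sym (weight-covers {U} {V} UV⊆Z)) 0≤b-a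
  ... | violates violated = ⊥-elim (not-violated violated)
  ... | avoids U⊈Z = ℤP.≤-reflexive (sym (weight-avoids {U} {V} U⊈Z))

module Implications {n k : ℕ} (γ : ℚ) (a>0 : 0ℤ ℤ.< ↥ γ) (a<b : ↥ γ ℤ.< ↧ γ)
                    (X Y : Fin k → Subset n) (X0 Y0 : Subset n) where
  open Sums
  open Signs
  open IndexSets
  open Weights {n} γ a>0 a<b

  ⊨ : Subset k → Set
  ⊨ L = Entails γ X Y L X0 Y0

  w₀ : Subset n → ℤ
  w₀ = weight X0 Y0

  w : Fin k → Subset n → ℤ
  w i = weight (X i) (Y i)

  Admissible : Subset k → Set
  Admissible L = Nonempty L × EnforcesHomogeneity X Y L
               × ((⋃[ L ] X) ⊆ X0 × X0 ⊆ (⋃[ L ] (λ i → X i ∪ Y i)))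
               × Y0 ⊆ (X0 ∪ (⋂[ L ] Y))

  ⊨-mono : ∀ {L L′} → L ⊆ L′ → ⊨ L → ⊨ L′
  ⊨-mono L⊆L′ L⊨ D sat = L⊨ D (λ i i∈L → sat i (L⊆L′ i∈L))

  -- X0 → Y0 with Y0 ⊆ X0 is never violated, so it follows from anything
  trivial-⊨ : Y0 ⊆ X0 → ∀ L → ⊨ L
  trivial-⊨ Y0⊆X0 L D _ =
    Equivalence.from (sat⇔weight≥0 D X0 Y0) (∑-nonneg D (λ Z _ → weight-≥0 X0 Y0 Z never-violated))
    where
    never-violated : ∀ {Z} → ¬ Violates X0 Y0 Z
    never-violated (X0⊆Z , X0Y0⊈Z) = X0Y0⊈Z (λ x∈ → [ X0⊆Z , X0⊆Z ∘ Y0⊆X0 ]′ (x∈p∪q⁻ X0 Y0 x∈))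

  module Soundness (k-bound : + k * (b - a) ℤ.≤ b) {L : Subset k} (adm : Admissible L) where

    homogeneous : EnforcesHomogeneity X Y L
    homogeneous = proj₁ (proj₂ adm)

    ⋃X⊆X0 : (⋃[ L ] X) ⊆ X0
    ⋃X⊆X0 = proj₁ (proj₁ (proj₂ (proj₂ adm)))

    X0⊆⋃XY : X0 ⊆ (⋃[ L ] (λ i → X i ∪ Y i))
    X0⊆⋃XY = proj₂ (proj₁ (proj₂ (proj₂ adm)))

    Y0⊆X0∪⋂Y : Y0 ⊆ (X0 ∪ (⋂[ L ] Y))
    Y0⊆X0∪⋂Y = proj₂ (proj₂ (proj₂ adm))

    ms : List (Fin k)
    ms = members L

    s : ℕ
    s = length ms

    premise⊆X0 : ∀ {i} → i ∈ L → X i ⊆ X0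
    premise⊆X0 i∈L = ⋃X⊆X0 ∘ ⊆-⋃[] X i∈L

    covers-conclusion : ∀ {i Z} → i ∈ L → X i ∪ Y i ⊆ Z → X0 ⊆ Z → X0 ∪ Y0 ⊆ Z
    covers-conclusion {i} i∈L XiYi⊆Z X0⊆Z x∈ with x∈p∪q⁻ X0 Y0 x∈
    ... | inj₁ x∈X0 = X0⊆Z x∈X0
    ... | inj₂ x∈Y0 with x∈p∪q⁻ X0 _ (Y0⊆X0∪⋂Y x∈Y0)
    ...   | inj₁ x∈X0 = X0⊆Z x∈X0
    ...   | inj₂ x∈⋂Y = XiYi⊆Z (q⊆p∪q (X i) (Y i) (⋂[]-⊆ Y i∈L x∈⋂Y))

    premise-violated : ∀ {i Z} → i ∈ L → Violates X0 Y0 Z → Violates (X i) (Y i) Z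
    premise-violated i∈L (X0⊆Z , X0Y0⊈Z) =
      ⊆-trans (premise⊆X0 i∈L) X0⊆Z , λ XiYi⊆Z → X0Y0⊈Z (covers-conclusion i∈L XiYi⊆Z X0⊆Z)

    all-avoided : ∀ {Z} → ¬ (X0 ⊆ Z) → (∀ i → i ∈ L → ¬ Violates (X i) (Y i) Z) → ∀ i → i ∈ L → ¬ (X i ⊆ Z)
    all-avoided {Z} X0⊈Z none-violated =
      [ (λ all-avoid → all-avoid) , (λ all-cover → ⊥-elim (X0⊈Z (covers-all all-cover))) ]′
        (homogeneous Z (λ i i∈L → not-violated⇒avoids-or-covers (none-violated i i∈L)))
      where
      covers-all : (∀ i → i ∈ L → X i ∪ Y i ⊆ Z) → X0 ⊆ Z
      covers-all all-cover = ⊆-trans X0⊆⋃XY (⋃[]-least (λ i → X i ∪ Y i) all-cover)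

    -- one violated premise keeps the total below s(b − a) − b ≤ k(b − a) − b ≤ 0
    one-violated-bound : ∀ {i Z} → i ∈ L → Violates (X i) (Y i) Z → ∑[ ms ] (λ j → w j Z) ℤ.≤ 0ℤ
    one-violated-bound {i} {Z} i∈L violated =
      ℤP.≤-trans (∑-≤-one-smaller ms {λ j → w j Z} (b - a) b (members⁺ i∈L) wi≤ (λ j _ → weight-≤ (X j) (Y j) Z))
                 (ℤP.i≤j⇒i-j≤0 (ℤP.≤-trans s[b-a]≤k[b-a] k-bound))
      where
      neg-as-difference : ∀ a b → - a ≡ b - a - b
      neg-as-difference = solve-∀
      wi≤ : w i Z ℤ.≤ b - a - b
      wi≤ = ℤP.≤-reflexive (trans (weight-violates violated) (neg-as-difference a b))
      s[b-a]≤k[b-a] : + s * (b - a) ℤ.≤ + k * (b - a)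
      s[b-a]≤k[b-a] = ℤP.*-monoʳ-≤-nonNeg (b - a) {{ℤ.nonNegative 0≤b-a}} (ℤ.+≤+ (length-members L))

    local-bound : ∀ Z → ∑[ ms ] (λ i → w i Z) ℤ.≤ + s * w₀ Z
    local-bound Z = by-position (position X0 Y0 Z)
      where
      total : ℤ
      total = ∑[ ms ] (λ i → w i Z)

      bound-by : ∀ {t} → w₀ Z ≡ t → total ℤ.≤ + s * t → total ℤ.≤ + s * w₀ Z
      bound-by w₀≡t = subst (λ t → total ℤ.≤ + s * t) (sym w₀≡t)

      avoiding-bound : ¬ (X0 ⊆ Z) → Dec (Σ (Fin k) (λ i → i ∈ L × Violates (X i) (Y i) Z)) →
                       total ℤ.≤ + s * 0ℤ
      avoiding-bound _ (yes (i , i∈L , violated)) =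
        subst (total ℤ.≤_) (sym (ℤP.*-zeroʳ (+ s))) (one-violated-bound i∈L violated)
      avoiding-bound X0⊈Z (no none-violated) = ∑-≤ ms 0ℤ (λ i i∈ → ℤP.≤-reflexive (weight-avoids {X i} {Y i}
        (all-avoided X0⊈Z (λ j j∈L violated → none-violated (j , j∈L , violated)) i (members⁻ i∈))))

      by-position : Position X0 Y0 Z → total ℤ.≤ + s * w₀ Z
      by-position (covers X0Y0⊆Z) =
        bound-by (weight-covers X0Y0⊆Z) (∑-≤ ms (b - a) (λ i _ → weight-≤ (X i) (Y i) Z))
      by-position (violates violated) = bound-by (weight-violates violated)
        (∑-≤ ms (- a) (λ i i∈ → ℤP.≤-reflexive (weight-violates (premise-violated (members⁻ i∈) violated))))
      by-position (avoids X0⊈Z) = bound-by (weight-avoids {X0} {Y0} X0⊈Z)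
        (avoiding-bound X0⊈Z (any? (λ i → (i ∈? L) ×-dec violates? (X i) (Y i) Z)))

    -- summing the local bound over a data-set satisfying L, then dividing by |L| > 0
    soundness : ⊨ L
    soundness D sat =
      Equivalence.from (sat⇔weight≥0 D X0 Y0) (cancel ms (members⁺ (proj₂ (proj₁ adm))) s*total≥0)
      where
      open ℤP.≤-Reasoning
      s*total≥0 : 0ℤ ℤ.≤ + s * ∑[ D ] w₀
      s*total≥0 = begin
        0ℤ                                   ≤⟨ ∑-nonneg ms (λ i i∈ →
                                                  Equivalence.to (sat⇔weight≥0 D (X i) (Y i)) (sat i (members⁻ i∈))) ⟩
        ∑[ ms ] (λ i → ∑[ D ] w i)           ≡⟨ ∑-swap ms D w ⟩
        ∑[ D ] (λ Z → ∑[ ms ] (λ i → w i Z)) ≤⟨ ∑-mono D local-bound ⟩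
        ∑[ D ] (λ Z → + s * w₀ Z)            ≡⟨ ∑-* D (+ s) w₀ ⟩
        + s * ∑[ D ] w₀                      ∎
      cancel : ∀ is {i : Fin k} {t} → i ∈ₗ is → 0ℤ ℤ.≤ + length is * t → 0ℤ ℤ.≤ t
      cancel (_ ∷ is) {t = t} _ 0≤mt = ℤP.*-cancelˡ-≤-pos 0ℤ t (+ suc (length is))
        (subst (ℤ._≤ + suc (length is) * t) (sym (ℤP.*-zeroʳ (+ suc (length is)))) 0≤mt)

  module Completeness (Y0⊈X0 : ¬ (Y0 ⊆ X0)) where

    X0-violates : Violates X0 Y0 X0
    X0-violates = ⊆-refl , λ X0Y0⊆X0 → Y0⊈X0 (X0Y0⊆X0 ∘ q⊆p∪q X0 Y0)

    excess : Fin k → Subset n → ℤ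
    excess i Z = w i Z - w₀ Z

    excess-≥ : ∀ i Z → - b ℤ.≤ excess i Z
    excess-≥ i Z = subst (ℤ._≤ excess i Z) (-a-[b-a] a b)
      (ℤP.+-mono-≤ (weight-≥ (X i) (Y i) Z) (ℤP.neg-mono-≤ (weight-≤ X0 Y0 Z)))
      where
      -a-[b-a] : ∀ a b → - a + - (b - a) ≡ - b
      -a-[b-a] = solve-∀

    Refutation : Subset k → Set
    Refutation S = Σ (DataSet n) λ E → ∑[ E ] w₀ ℤ.≤ - 1ℤ × (∀ i → i ∈ S → 1ℤ ℤ.≤ ∑[ E ] excess i)

    refutation-∅ : ∀ {S} → ¬ Nonempty S → Refutation S
    refutation-∅ empty = X0 ∷ [] , w₀[X0]≤-1 , λ i i∈S → ⊥-elim (empty (i , i∈S))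
      where
      w₀[X0]≤-1 : w₀ X0 + 0ℤ ℤ.≤ - 1ℤ
      w₀[X0]≤-1 = subst (ℤ._≤ - 1ℤ) (sym (trans (ℤP.+-identityʳ (w₀ X0)) (weight-violates X0-violates)))
                    (ℤP.neg-mono-≤ 1≤a)

    -- M copies of the full transaction ⊤ plus (b − a) copies of a refutation E,
    -- with M = −Σ_E w₀ − 1, satisfy every premise of S but violate the conclusion
    refutation⇒¬⊨ : ∀ {S} → Refutation S → ¬ ⊨ S
    refutation⇒¬⊨ {S} (E , T≤-1 , gains) S⊨ = 0≰-1 (ℤP.≤-trans conclusion-holds conclusion-weight)
      where
      T : ℤ
      T = ∑[ E ] w₀
      M c : ℕ
      M = ℤ.∣ - T - 1ℤ ∣
      c = ℤ.∣ b - a ∣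
      D : DataSet n
      D = replicate M ⊤ ++ concat (replicate c E)

      M≡ : + M ≡ - T - 1ℤ
      M≡ = ℤP.0≤i⇒+∣i∣≡i (ℤP.i≤j⇒0≤j-i (subst (ℤ._≤ - T) (ℤP.neg-involutive 1ℤ) (ℤP.neg-mono-≤ T≤-1)))

      c≡ : + c ≡ b - a
      c≡ = ℤP.0≤i⇒+∣i∣≡i 0≤b-a

      amplified : ∀ U V → ∑[ D ] weight U V ≡ (b - a) * (∑[ E ] weight U V - T - 1ℤ)
      amplified U V = begin
        ∑[ D ] weight U V
          ≡⟨ ∑-++ (replicate M ⊤) _ _ ⟩
        ∑[ replicate M ⊤ ] weight U V + ∑[ concat (replicate c E) ] weight U V
          ≡⟨ cong₂ _+_ (∑-replicate M ⊤ _) (∑-copies c E _) ⟩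
        + M * weight U V ⊤ + + c * ∑[ E ] weight U V
          ≡⟨ cong₂ (λ m x → m * x + + c * ∑[ E ] weight U V) M≡ (weight-covers {U} {V} (λ _ → ∈⊤)) ⟩
        (- T - 1ℤ) * (b - a) + + c * ∑[ E ] weight U V
          ≡⟨ cong (λ x → (- T - 1ℤ) * (b - a) + x * ∑[ E ] weight U V) c≡ ⟩
        (- T - 1ℤ) * (b - a) + (b - a) * ∑[ E ] weight U V
          ≡⟨ factor T (b - a) (∑[ E ] weight U V) ⟩
        (b - a) * (∑[ E ] weight U V - T - 1ℤ) ∎
        where
        open ≡-Reasoning
        factor : ∀ t d x → (- t - 1ℤ) * d + d * x ≡ d * (x - t - 1ℤ)
        factor = solve-∀

      premise-holds : ∀ i → i ∈ S → Sat γ D (X i) (Y i)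
      premise-holds i i∈S = Equivalence.from (sat⇔weight≥0 D (X i) (Y i))
        (subst (0ℤ ℤ.≤_) (sym (amplified (X i) (Y i))) (0≤* 0≤b-a (ℤP.i≤j⇒0≤j-i gain)))
        where
        gain : 1ℤ ℤ.≤ ∑[ E ] w i - T
        gain = subst (1ℤ ℤ.≤_) (∑-- E (w i) w₀) (gains i i∈S)

      conclusion-holds : 0ℤ ℤ.≤ ∑[ D ] w₀
      conclusion-holds = Equivalence.to (sat⇔weight≥0 D X0 Y0) (S⊨ D premise-holds)

      conclusion-weight : ∑[ D ] w₀ ℤ.≤ - 1ℤ
      conclusion-weight = subst (ℤ._≤ - 1ℤ) (sym (trans (amplified X0 Y0) (cancel T (b - a))))
                            (ℤP.neg-mono-≤ 1≤b-a)
        where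
        cancel : ∀ t d → d * (t - t - 1ℤ) ≡ - d
        cancel = solve-∀

      0≰-1 : ¬ (0ℤ ℤ.≤ - 1ℤ)
      0≰-1 ()

    Drops : Subset k → Fin k → Subset n → Set
    Drops S i Z = w₀ Z ℤ.≤ 0ℤ × (∀ j → j ∈ S → 0ℤ ℤ.≤ excess j Z) × 1ℤ ℤ.≤ excess i Z

    drops? : ∀ S i Z → Dec (Drops S i Z)
    drops? S i Z = (w₀ Z ℤ.≤? 0ℤ) ×-dec all? (λ j → (j ∈? S) →-dec (0ℤ ℤ.≤? excess j Z))
                   ×-dec (1ℤ ℤ.≤? excess i Z)

    -- a refutation E′ of S without i extends to S by prepending m = 1 + b·|E′| copies of Z:
    -- these outweigh the worst case −b·|E′| of E′ on premise i
    drop-premise : ∀ {S i Z} → Drops S i Z → Refutation (S without i) → Refutation S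
    drop-premise {S} {i} {Z} (w₀≤0 , excess≥0 , excess-i≥1) (E′ , T′≤-1 , gains′) = E , T≤-1 , gains
      where
      ℓ m : ℕ
      ℓ = length E′
      m = suc (↧ₙ γ ℕ.* ℓ)
      E : DataSet n
      E = replicate m Z ++ E′

      m≡ : + m ≡ 1ℤ + b * + ℓ
      m≡ = cong (λ x → 1ℤ + x) (ℤP.pos-* (↧ₙ γ) ℓ)

      ∑E : ∀ f → ∑[ E ] f ≡ + m * f Z + ∑[ E′ ] f
      ∑E f = trans (∑-++ (replicate m Z) E′ f) (cong (_+ ∑[ E′ ] f) (∑-replicate m Z f))

      T≤-1 : ∑[ E ] w₀ ℤ.≤ - 1ℤ
      T≤-1 = subst (ℤ._≤ - 1ℤ) (sym (∑E w₀)) (ℤP.+-mono-≤ (*≤0 {+ m} (ℤ.+≤+ ℕ.z≤n) w₀≤0) T′≤-1)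

      gains : ∀ j → j ∈ S → 1ℤ ℤ.≤ ∑[ E ] excess j
      gains j j∈S with j ≟ᶠ i
      ... | no j≢i = subst (1ℤ ℤ.≤_) (sym (∑E (excess j)))
          (ℤP.+-mono-≤ (0≤* {+ m} (ℤ.+≤+ ℕ.z≤n) (excess≥0 j j∈S)) (gains′ j (x∈p∧x≢y⇒x∈p-y j∈S j≢i)))
      ... | yes refl = subst₂ ℤ._≤_ (trans (cong (_+ + ℓ * - b) m≡) (cancel b (+ ℓ))) (sym (∑E (excess i)))
          (ℤP.+-mono-≤ m≤m*excess (∑-≥ E′ (- b) (excess-≥ i)))
        where
        cancel : ∀ b l → 1ℤ + b * l + l * - b ≡ 1ℤ
        cancel = solve-∀
        m≤m*excess : + m ℤ.≤ + m * excess i Z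
        m≤m*excess = subst (ℤ._≤ + m * excess i Z) (ℤP.*-identityʳ (+ m)) (ℤP.*-monoˡ-≤-nonNeg (+ m) excess-i≥1)

    drops-if-conclusion-violated : ∀ {S i Z} → Violates X0 Y0 Z → ¬ Violates (X i) (Y i) Z → Drops S i Z
    drops-if-conclusion-violated {S} {i} {Z} conclusion-violated not-violated =
      subst (ℤ._≤ 0ℤ) (sym w₀≡) -a≤0 ,
      (λ j _ → subst (0ℤ ℤ.≤_) (sym (excess≡ j)) (ℤP.i≤j⇒0≤j-i (weight-≥ (X j) (Y j) Z))) ,
      subst (1ℤ ℤ.≤_) (sym (excess≡ i))
        (subst₂ ℤ._≤_ (ℤP.+-identityˡ 1ℤ) (plus-as-minus (w i Z) a)
          (ℤP.+-mono-≤ (weight-≥0 (X i) (Y i) Z not-violated) 1≤a))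
      where
      w₀≡ : w₀ Z ≡ - a
      w₀≡ = weight-violates conclusion-violated
      excess≡ : ∀ j → excess j Z ≡ w j Z - - a
      excess≡ j = cong (λ t → w j Z - t) w₀≡
      plus-as-minus : ∀ x a → x + a ≡ x - - a
      plus-as-minus = solve-∀

    drops-if-premise-covered : ∀ {S i Z} → ¬ (X0 ⊆ Z) → (∀ j → j ∈ S → ¬ Violates (X j) (Y j) Z) →
                               X i ∪ Y i ⊆ Z → Drops S i Z
    drops-if-premise-covered {S} {i} {Z} X0⊈Z none-violated XiYi⊆Z =
      ℤP.≤-reflexive w₀≡ ,
      (λ j j∈S → subst (0ℤ ℤ.≤_) (sym (excess≡ j)) (weight-≥0 (X j) (Y j) Z (none-violated j j∈S))) ,
      subst (1ℤ ℤ.≤_) (sym (trans (excess≡ i) (weight-covers XiYi⊆Z))) 1≤b-a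
      where
      w₀≡ : w₀ Z ≡ 0ℤ
      w₀≡ = weight-avoids {X0} {Y0} X0⊈Z
      excess≡ : ∀ j → excess j Z ≡ w j Z
      excess≡ j = trans (cong (λ t → w j Z - t) w₀≡) (ℤP.+-identityʳ (w j Z))

    module Stuck {S : Subset k} (stuck : ∀ i Z → i ∈ S → ¬ Drops S i Z) (nonempty : Nonempty S) where

      all-violated : ∀ {i Z} → i ∈ S → Violates X0 Y0 Z → Violates (X i) (Y i) Z
      all-violated {i} {Z} i∈S conclusion-violated with violates? (X i) (Y i) Z
      ... | yes violated = violated
      ... | no not-violated = ⊥-elim (stuck i Z i∈S (drops-if-conclusion-violated conclusion-violated not-violated))

      none-covered : ∀ {i Z} → i ∈ S → ¬ (X0 ⊆ Z) → (∀ j → j ∈ S → ¬ Violates (X j) (Y j) Z) → ¬ (X i ∪ Y i ⊆ Z)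
      none-covered {i} {Z} i∈S X0⊈Z none-violated XiYi⊆Z =
        stuck i Z i∈S (drops-if-premise-covered X0⊈Z none-violated XiYi⊆Z)

      -- take Z = X0
      premise⊆X0 : ∀ {i} → i ∈ S → X i ⊆ X0
      premise⊆X0 i∈S = proj₁ (all-violated i∈S X0-violates)

      -- take Z = [n] ∖ {y} for y ∈ Y0 ∖ X0: it violates the conclusion, so it omits y from each Y i
      conclusion⊆premise : ∀ {i y} → i ∈ S → y ∈ Y0 → y ∉ X0 → y ∈ Y i
      conclusion⊆premise {i} {y} i∈S y∈Y0 y∉X0 with y ∈? Y i
      ... | yes y∈Yi = y∈Yi
      ... | no y∉Yi = ⊥-elim (proj₂ (all-violated i∈S (X0⊆Z , X0Y0⊈Z)) XiYi⊆Z)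
        where
        Z : Subset n
        Z = ∁ ⁅ y ⁆
        y∉⇒⊆Z : ∀ {U} → y ∉ U → U ⊆ Z
        y∉⇒⊆Z {U} y∉U {x} x∈U = x∉p⇒x∈∁p (λ x∈⁅y⁆ → y∉U (subst (_∈ U) (x∈⁅y⁆⇒x≡y y x∈⁅y⁆) x∈U))
        X0⊆Z : X0 ⊆ Z
        X0⊆Z = y∉⇒⊆Z y∉X0
        X0Y0⊈Z : ¬ (X0 ∪ Y0 ⊆ Z)
        X0Y0⊈Z X0Y0⊆Z = x∈∁p⇒x∉p (X0Y0⊆Z (q⊆p∪q X0 Y0 y∈Y0)) (x∈⁅x⁆ y)
        XiYi⊆Z : X i ∪ Y i ⊆ Z
        XiYi⊆Z = y∉⇒⊆Z (λ y∈XiYi → [ y∉X0 ∘ premise⊆X0 i∈S , y∉Yi ]′ (x∈p∪q⁻ (X i) (Y i) y∈XiYi))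

      -- if Z contains X0 it covers every premise, otherwise it avoids every premise
      homogeneous : EnforcesHomogeneity X Y S
      homogeneous Z split = by-cases (X0 ⊆? Z)
        where
        none-violated : ∀ j → j ∈ S → ¬ Violates (X j) (Y j) Z
        none-violated j j∈S = avoids-or-covers⇒not-violated (split j j∈S)
        by-cases : Dec (X0 ⊆ Z) → (∀ i → i ∈ S → ¬ (X i ⊆ Z)) ⊎ (∀ i → i ∈ S → X i ∪ Y i ⊆ Z)
        by-cases (yes X0⊆Z) = inj₂ λ i i∈S → covered i∈S (split i i∈S)
          where
          covered : ∀ {i} → i ∈ S → ¬ (X i ⊆ Z) ⊎ X i ∪ Y i ⊆ Z → X i ∪ Y i ⊆ Z
          covered i∈S (inj₁ Xi⊈Z) = ⊥-elim (Xi⊈Z (⊆-trans (premise⊆X0 i∈S) X0⊆Z))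
          covered i∈S (inj₂ XiYi⊆Z) = XiYi⊆Z
        by-cases (no X0⊈Z) = inj₁ λ i i∈S → avoided i∈S (split i i∈S)
          where
          avoided : ∀ {i} → i ∈ S → ¬ (X i ⊆ Z) ⊎ X i ∪ Y i ⊆ Z → ¬ (X i ⊆ Z)
          avoided i∈S (inj₁ Xi⊈Z) = Xi⊈Z
          avoided i∈S (inj₂ XiYi⊆Z) = ⊥-elim (none-covered i∈S X0⊈Z none-violated XiYi⊆Z)

      ⋃X⊆X0 : (⋃[ S ] X) ⊆ X0
      ⋃X⊆X0 = ⋃[]-least X (λ i → premise⊆X0)

      -- Z = ⋃_{i∈S} X i ∪ Y i covers every premise, so it cannot avoid X0
      X0⊆⋃XY : X0 ⊆ (⋃[ S ] (λ i → X i ∪ Y i))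
      X0⊆⋃XY with X0 ⊆? ⋃[ S ] (λ i → X i ∪ Y i)
      ... | yes X0⊆Z = X0⊆Z
      ... | no X0⊈Z = ⊥-elim (none-covered (proj₂ nonempty) X0⊈Z
                                (λ j j∈S (_ , XjYj⊈Z) → XjYj⊈Z (covered j∈S)) (covered (proj₂ nonempty)))
        where
        covered : ∀ {j} → j ∈ S → X j ∪ Y j ⊆ ⋃[ S ] (λ i → X i ∪ Y i)
        covered = ⊆-⋃[] (λ i → X i ∪ Y i)

      Y0⊆X0∪⋂Y : Y0 ⊆ (X0 ∪ (⋂[ S ] Y))
      Y0⊆X0∪⋂Y {y} y∈Y0 with y ∈? X0
      ... | yes y∈X0 = x∈p∪q⁺ (inj₁ y∈X0)
      ... | no y∉X0 = x∈p∪q⁺ (inj₂ (∈-⋂[] Y (λ i i∈S → conclusion⊆premise i∈S y∈Y0 y∉X0)))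

      admissible : Admissible S
      admissible = nonempty , homogeneous , (⋃X⊆X0 , X0⊆⋃XY) , Y0⊆X0∪⋂Y

    Outcome : Subset k → Set
    Outcome S = Σ (Subset k) (λ S′ → S′ ⊆ S × Admissible S′) ⊎ Refutation S

    search : ∀ S → Outcome S
    search = All.wfRec ⊂-wellFounded _ Outcome step
      where
      step : ∀ S → (∀ {S′} → S′ ⊂ S → Outcome S′) → Outcome S
      step S recurse = by-cases (anySubset? (λ Z → any? (λ i → (i ∈? S) ×-dec drops? S i Z)))
        where
        stuck-or-empty : (∀ i Z → i ∈ S → ¬ Drops S i Z) → Dec (Nonempty S) → Outcome S
        stuck-or-empty stuck (yes nonempty) = inj₁ (S , ⊆-refl , Stuck.admissible stuck nonempty)
        stuck-or-empty stuck (no empty) = inj₂ (refutation-∅ empty)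
        by-cases : Dec (Σ (Subset n) λ Z → Σ (Fin k) λ i → i ∈ S × Drops S i Z) → Outcome S
        by-cases (yes (Z , i , i∈S , drops)) =
          Sum.map (λ (S′ , S′⊆S-i , adm) → S′ , ⊆-trans S′⊆S-i (proj₁ (x∈p⇒p-x⊂p i∈S)) , adm)
                  (drop-premise drops)
                  (recurse (x∈p⇒p-x⊂p i∈S))
        by-cases (no no-drop) =
          stuck-or-empty (λ i Z i∈S drops → no-drop (Z , i , i∈S , drops)) (any? (_∈? S))

    complete : ∀ {L} → ⊨ L → Σ (Subset k) (λ S → S ⊆ L × Admissible S)
    complete {L} L⊨ = [ (λ admissible-subset → admissible-subset) ,
                        (λ refutation → ⊥-elim (refutation⇒¬⊨ refutation L⊨)) ]′ (search L)

  module Characterisation (k-bound : + k * (b - a) ℤ.≤ b) where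

    Condition3 : Set
    Condition3 = Y0 ⊆ X0 ⊎ Σ (Subset k) Admissible

    condition3⇒⊨ : Condition3 → ⊨ ⊤
    condition3⇒⊨ (inj₁ Y0⊆X0) = trivial-⊨ Y0⊆X0 ⊤
    condition3⇒⊨ (inj₂ (L , adm)) = ⊨-mono (λ _ → ∈⊤) (Soundness.soundness k-bound adm)

    ⊨⇒condition3 : ⊨ ⊤ → Condition3
    ⊨⇒condition3 ⊤⊨ = by-cases (Y0 ⊆? X0)
      where
      by-cases : Dec (Y0 ⊆ X0) → Condition3
      by-cases (yes Y0⊆X0) = inj₁ Y0⊆X0
      by-cases (no Y0⊈X0) = let (S , _ , adm) = Completeness.complete Y0⊈X0 {⊤} ⊤⊨ in inj₂ (S , adm)

    ⊨? : ∀ L → Dec (⊨ L)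
    ⊨? L = by-cases (Y0 ⊆? X0)
      where
      by-cases : Dec (Y0 ⊆ X0) → Dec (⊨ L)
      by-cases (yes Y0⊆X0) = yes (trivial-⊨ Y0⊆X0 L)
      by-cases (no Y0⊈X0) = [ (λ (S , S⊆L , adm) → yes (⊨-mono S⊆L (Soundness.soundness k-bound adm))) ,
                               (λ refutation → no (Completeness.refutation⇒¬⊨ Y0⊈X0 refutation)) ]′
                             (Completeness.search Y0⊈X0 L)

    ProperlyEntailed : Set
    ProperlyEntailed = Σ (Subset k) (λ L → EntailsProperly γ X Y L X0 Y0)

    ⊨⇒proper : ∀ {L} → ⊨ L → ProperlyEntailed
    ⊨⇒proper {L} = All.wfRec ⊂-wellFounded _ (λ L → ⊨ L → ProperlyEntailed) step L
      where
      step : ∀ L → (∀ {L′} → L′ ⊂ L → ⊨ L′ → ProperlyEntailed) → ⊨ L → ProperlyEntailed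
      step L recurse L⊨ = by-cases (anySubset? (λ L′ → (L′ ⊂? L) ×-dec ⊨? L′))
        where
        by-cases : Dec (Σ (Subset k) (λ L′ → L′ ⊂ L × ⊨ L′)) → ProperlyEntailed
        by-cases (yes (L′ , L′⊂L , L′⊨)) = recurse L′⊂L L′⊨
        by-cases (no no-smaller) = L , L⊨ , λ L′ L′⊂L L′⊨ → no-smaller (L′ , L′⊂L , L′⊨)

    proper⇒⊨ : ProperlyEntailed → ⊨ ⊤
    proper⇒⊨ (L , L⊨ , _) = ⊨-mono (λ _ → ∈⊤) L⊨

theorem5 : (n k : ℕ) (γ : ℚ) (X Y : Fin k → Subset n) (X0 Y0 : Subset n) →
  0ℚ < γ → γ < 1ℚ → 1 ≤ℕ k → ℕtoℚ (k ∸ 1) ≤ γ ℚ.* ℕtoℚ k →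
  (Entails γ X Y ⊤ X0 Y0 ⇔ Σ (Subset k) (λ L → EntailsProperly γ X Y L X0 Y0))
  × (Entails γ X Y ⊤ X0 Y0 ⇔
       (Y0 ⊆ X0 ⊎ Σ (Subset k) (λ L → Nonempty L × EnforcesHomogeneity X Y L
          × ((⋃[ L ] X) ⊆ X0 × X0 ⊆ (⋃[ L ] (λ i → X i ∪ Y i)))
          × Y0 ⊆ (X0 ∪ (⋂[ L ] Y)))))
theorem5 n k γ X Y X0 Y0 γ>0 γ<1 k≥1 γ≥[k-1]/k =
  mk⇔ ⊨⇒proper proper⇒⊨ , mk⇔ ⊨⇒condition3 condition3⇒⊨
  where
  open RationalBounds
  open Implications γ (numerator-pos γ γ>0) (numerator<denominator γ γ<1) X Y X0 Y0
  open Characterisation (confidence-bound γ k k≥1 γ≥[k-1]/k)
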